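{- In $\mathcal{E}$-Wythoff, a position $(a,b)$ with $a \leq b$ has Sprague-Grundy value $1$ if and only if $(a,b) = (\lfloor \phi n \rfloor - 1, \lfloor \phi n \rfloor +n-1)$ for some integer $n \geq 1$, where $\phi=(1+\sqrt5)/2$.
   Context: A position is an unordered pair $(a,b)$ of nonnegative integers (pile sizes). $\mathcal{E}$-Wythoff: a move either removes a positive number of tokens from one pile, or removes the same positive number of tokens from both piles, or removes $k$ tokens from the smaller pile (or from either pile if the piles are equal) and $l$ tokens from the other pile, for integers $k \geq 1$, $l\ge 0$ with $l < k$. The Sprague-Grundy function is $\mathcal{G}(p)=\mathrm{mex}\{\mathcal{G}(q): q \text{ reachable from } p \text{ in one move}\}$, where $\mathrm{mex}(S)$ is the least nonnegative integer not in $S$ and $\mathrm{mex}\{\}=0$. -}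

module Defs where

open import Data.Nat using (ℕ; _+_; _*_; _∸_; _≤_; _<_)
open import Data.Product using (Σ; _×_; ∃; ∃-syntax)
open import Data.Sum using (_⊎_)
open import Relation.Binary.PropositionalEquality using (_≡_; _≢_)

-- Positions are represented by ordered pairs (a , b) of pile sizes; the move
-- relation below is invariant under swapping both coordinates, so this models
-- unordered pairs faithfully.

data Move (a b c d : ℕ) : Set where
  nimˡ : c < a → d ≡ b → Move a b c d
  nimʳ : c ≡ a → d < b → Move a b c d
  diag : (t : ℕ) → 1 ≤ t → a ≡ c + t → b ≡ d + t → Move a b c d
  extˡ : a ≤ b → (k l : ℕ) → l < k → a ≡ c + k → b ≡ d + l → Move a b c d
  extʳ : b ≤ a → (k l : ℕ) → l < k → b ≡ d + k → a ≡ c + l → Move a b c d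

IsSG : (ℕ → ℕ → ℕ) → Set
IsSG g = ∀ a b →
  (∀ c d → Move a b c d → g c d ≢ g a b) ×
  (∀ m → m < g a b → ∃[ c ] ∃[ d ] (Move a b c d × g c d ≡ m))

-- m = ⌊ φ n ⌋ with φ = (1 + √5)/2, i.e.  m ≤ φ n < m + 1, i.e.
--   2m - n ≤ n√5  and  n√5 < 2m + 2 - n,
-- written with natural-number arithmetic (squaring both sides).
IsFloorPhi : ℕ → ℕ → Set
IsFloorPhi n m =
  ((2 * m ∸ n) * (2 * m ∸ n) ≤ 5 * (n * n)) ×
  (n < 2 * m + 2 × 5 * (n * n) < (2 * m + 2 ∸ n) * (2 * m + 2 ∸ n))

module Submission where

-- With A n = ⌊φ n⌋ and B n = A n + n, we prove by induction along moves that
-- a position has value 0 iff it is a Wythoff pair (A n , B n) or its mirror,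
-- and value 1 iff it is a shifted pair (A n − 1 , B n − 1), n ≥ 1, or its
-- mirror.

open import Defs
open import Data.Empty using (⊥; ⊥-elim)
open import Data.List using (_∷_; [])
open import Data.Nat using (ℕ; zero; suc; pred; _+_; _*_; _∸_; _≤_; _<_; z≤n; s≤s; _≤?_; _≟_; >-nonZero)
open import Data.Nat.Induction using (<-rec)
open import Data.Nat.Properties
open import Data.Nat.Tactic.RingSolver using (solve)
open import Algebra.Properties.CommutativeSemigroup +-commutativeSemigroup using (xy∙z≈xz∙y)
open import Data.Product using (_×_; ∃-syntax; _,_; proj₁; proj₂)
open import Data.Sum using (_⊎_; inj₁; inj₂)
open import Function.Bundles using (_⇔_; mk⇔; Equivalence)
open import Function.Construct.Composition using (_⇔-∘_)
open import Relation.Binary.Core using (_Preserves_⟶_)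
open import Relation.Binary.Definitions using (tri<; tri≈; tri>)
open import Relation.Binary.PropositionalEquality
open import Relation.Nullary using (¬_; yes; no; Dec)

StrictlyIncreasing : (ℕ → ℕ) → Set
StrictlyIncreasing f = f Preserves _<_ ⟶ _<_

increasing-by-steps : ∀ f → (∀ n → f n < f (suc n)) → StrictlyIncreasing f
increasing-by-steps f step {i} {suc j} (s≤s i≤j) with m≤n⇒m<n∨m≡n i≤j
... | inj₁ i<j = <-trans (increasing-by-steps f step i<j) (step j)
... | inj₂ refl = step j

module _ {f : ℕ → ℕ} (f-mono : StrictlyIncreasing f) where

  monotone : ∀ {i j} → i ≤ j → f i ≤ f j
  monotone i≤j with m≤n⇒m<n∨m≡n i≤j
  ... | inj₁ i<j = <⇒≤ (f-mono i<j)
  ... | inj₂ refl = ≤-refl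

  reflect-< : ∀ {i j} → f i < f j → i < j
  reflect-< fi<fj = ≰⇒> (λ j≤i → <⇒≱ fi<fj (monotone j≤i))

  reflect-≤ : ∀ {i j} → f i ≤ f j → i ≤ j
  reflect-≤ fi≤fj = ≮⇒≥ (λ j<i → <⇒≱ (f-mono j<i) fi≤fj)

  injective : ∀ {i j} → f i ≡ f j → i ≡ j
  injective fi≡fj = ≤-antisym (reflect-≤ (≤-reflexive fi≡fj)) (reflect-≤ (≤-reflexive (sym fi≡fj)))

-- Comparing p with φ n (φ = (1 + √5)/2) in integer arithmetic: φ is the positive
-- root of x² = x + 1, so for n ≥ 1,  p < φ n  iff  p² < p n + n², and likewise
-- for ≤ and >.
infix 4 _<φ_ _≤φ_ _>φ_
_<φ_ _≤φ_ _>φ_ : ℕ → ℕ → Set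
p <φ n = p * p < p * n + n * n
p ≤φ n = p * p ≤ p * n + n * n
p >φ n = p * n + n * n < p * p

-- φ n ≥ n, so p > φ n forces p > n.
>φ⇒> : ∀ {p n} → p >φ n → n < p
>φ⇒> {p} {n} p>φn = ≰⇒> (λ p≤n → <⇒≱ p>φn (≤-trans (*-monoʳ-≤ p p≤n) (m≤m+n (p * n) (n * n))))

-- φ n > n for n ≥ 1, so p ≤ n implies p < φ n.
≤⇒<φ : ∀ {p n} → 1 ≤ n → p ≤ n → p <φ n
≤⇒<φ {p} {n} 1≤n p≤n = ≤-<-trans (*-monoʳ-≤ p p≤n) (m<m+n (p * n) (*-mono-< 1≤n 1≤n))

>φ-monoˡ : ∀ {p q n} → p >φ n → p ≤ q → q >φ n
>φ-monoˡ {p} {q} {n} p>φn p≤q = subst (_>φ n) (m+[n∸m]≡n p≤q) (grow (q ∸ p))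
  where
  grow : ∀ r → p + r >φ n
  grow r = begin-strict
    (p + r) * n + n * n                 ≡⟨ solve (p ∷ r ∷ n ∷ []) ⟩
    p * n + n * n + r * n               <⟨ +-mono-<-≤ p>φn rn≤ ⟩
    p * p + (r * (p + p) + r * r)       ≡⟨ solve (p ∷ r ∷ []) ⟩
    (p + r) * (p + r)                   ∎
    where
    open ≤-Reasoning
    rn≤ : r * n ≤ r * (p + p) + r * r
    rn≤ = ≤-trans (*-monoʳ-≤ r (≤-trans (<⇒≤ (>φ⇒> p>φn)) (m≤m+n p p))) (m≤m+n _ _)

-- p <φ n is downward closed in p.  (When n > 2 q, already q ≤ n.)
<φ-antimonoˡ : ∀ {p q n} → p <φ n → q ≤ p → q <φ n
<φ-antimonoˡ {p} {q} {n} p<φn q≤p =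
  shrink (p ∸ q) (subst (_<φ n) (sym (m+[n∸m]≡n q≤p)) p<φn)
  where
  shrink : ∀ r → q + r <φ n → q <φ n
  shrink r q+r<φn with n ≤? q + q
  ... | yes n≤2q = +-cancelʳ-< (r * n) (q * q) (q * n + n * n) (begin-strict
      q * q + r * n                       ≤⟨ +-monoʳ-≤ (q * q) rn≤ ⟩
      q * q + (r * (q + q) + r * r)       ≡⟨ solve (q ∷ r ∷ []) ⟩
      (q + r) * (q + r)                   <⟨ q+r<φn ⟩
      (q + r) * n + n * n                 ≡⟨ solve (q ∷ r ∷ n ∷ []) ⟩
      q * n + n * n + r * n               ∎)
    where
    open ≤-Reasoning
    rn≤ : r * n ≤ r * (q + q) + r * r
    rn≤ = ≤-trans (*-monoʳ-≤ r n≤2q) (m≤m+n _ _)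
  ... | no n≰2q = ≤⇒<φ (≤-<-trans z≤n 2q<n) (≤-trans (m≤m+n q q) (<⇒≤ 2q<n))
    where
    2q<n : q + q < n
    2q<n = ≰⇒> n≰2q

<φ-monoʳ : ∀ {p n n'} → p <φ n → n ≤ n' → p <φ n'
<φ-monoʳ {p} p<φn n≤n' = <-≤-trans p<φn (+-mono-≤ (*-monoʳ-≤ p n≤n') (*-mono-≤ n≤n' n≤n'))

>φ-antimonoʳ : ∀ {p n n'} → p >φ n' → n ≤ n' → p >φ n
>φ-antimonoʳ {p} p>φn' n≤n' = ≤-<-trans (+-mono-≤ (*-monoʳ-≤ p n≤n') (*-mono-≤ n≤n' n≤n')) p>φn'

-- φ is irrational: p² = p n + n² has no solution with n ≥ 1.  By descent: a
-- solution (p , n) has p > n and yields the smaller solution (n , p ∸ n); the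
-- fuel f ≥ n bounds the length of the descent.
φ-irrational : ∀ {p n} → 1 ≤ n → p * p ≢ p * n + n * n
φ-irrational {p} {n} = descent n {p} {n} ≤-refl
  where
  descent : ∀ f {p n} → n ≤ f → 1 ≤ n → p * p ≢ p * n + n * n
  descent zero n≤0 1≤n _ = <⇒≱ 1≤n n≤0
  descent (suc f) {p} {n} n≤1+f 1≤n eq with p ≤? n
  ... | yes p≤n = <⇒≢ (≤⇒<φ 1≤n p≤n) eq
  ... | no p≰n = descent f {n} {q} q≤f 1≤q (sym smaller)
    where
    q : ℕ
    q = p ∸ n
    n+q≡p : n + q ≡ p
    n+q≡p = m+[n∸m]≡n (<⇒≤ (≰⇒> p≰n))
    smaller : n * q + q * q ≡ n * n
    smaller = +-cancelˡ-≡ (n * n + n * q) _ _ (begin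
      n * n + n * q + (n * q + q * q)   ≡⟨ square q ⟩
      (n + q) * (n + q)                 ≡⟨ cong (λ x → x * x) n+q≡p ⟩
      p * p                             ≡⟨ eq ⟩
      p * n + n * n                     ≡⟨ cong (λ x → x * n + n * n) (sym n+q≡p) ⟩
      (n + q) * n + n * n               ≡⟨ times-n q ⟩
      n * n + n * q + n * n             ∎)
      where
      open ≡-Reasoning
      square : ∀ x → n * n + n * x + (n * x + x * x) ≡ (n + x) * (n + x)
      square x = solve (n ∷ x ∷ [])
      times-n : ∀ x → (n + x) * n + n * n ≡ n * n + n * x + n * n
      times-n x = solve (n ∷ x ∷ [])
    q<n : q < n
    q<n = ≰⇒> (λ n≤q → <⇒≢ (≤⇒<φ (≤-trans 1≤n n≤q) n≤q) (sym smaller))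
    q≤f : q ≤ f
    q≤f = ≤-pred (≤-trans q<n n≤1+f)
    1≤q : 1 ≤ q
    1≤q = n≢0⇒n>0 (λ q≡0 → <⇒≢ (*-mono-< 1≤n 1≤n) (sym (begin
      n * n           ≡⟨ sym smaller ⟩
      n * q + q * q   ≡⟨ cong (λ x → n * x + x * x) q≡0 ⟩
      n * 0 + 0       ≡⟨ cong (_+ 0) (*-zeroʳ n) ⟩
      0               ∎)))
      where open ≡-Reasoning

≤φ⇒<φ : ∀ {p n} → 1 ≤ n → p ≤φ n → p <φ n
≤φ⇒<φ {p} {n} 1≤n p≤φn = ≤∧≢⇒< p≤φn (φ-irrational {p} {n} 1≤n)

last-before-failure : (P : ℕ → Set) → (∀ m → Dec (P m)) → P 0 →
                      ∀ N → ¬ P N → ∃[ m ] (P m × ¬ P (suc m))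
last-before-failure P P? P0 zero ¬PN = ⊥-elim (¬PN P0)
last-before-failure P P? P0 (suc N) ¬P1+N with P? N
... | yes PN = N , PN , ¬P1+N
... | no ¬PN = last-before-failure P P? P0 N ¬PN

IsFloor : ℕ → ℕ → Set
IsFloor n m = m ≤φ n × suc m >φ n

-- Distinct integers cannot both be the floor, as p >φ n is upward closed.
floor-unique : ∀ {n m m'} → IsFloor n m → IsFloor n m' → m ≡ m'
floor-unique {n} {m} {m'} (m≤φn , 1+m>φn) (m'≤φn , 1+m'>φn) with <-cmp m m'
... | tri< m<m' _ _ = ⊥-elim (<⇒≱ (>φ-monoˡ 1+m>φn m<m') m'≤φn)
... | tri≈ _ m≡m' _ = m≡m'
... | tri> _ _ m'<m = ⊥-elim (<⇒≱ (>φ-monoˡ 1+m'>φn m'<m) m≤φn)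

2n+1>φn : ∀ n → suc (n + n) >φ n
2n+1>φn n = begin-strict
  suc (n + n) * n + n * n                                  <⟨ m<m+n _ (s≤s z≤n) ⟩
  suc (n + n) * n + n * n + suc (n * n + (n + n + n))      ≡⟨ solve (n ∷ []) ⟩
  suc (n + n) * suc (n + n)                                ∎
  where open ≤-Reasoning

-- The floor exists: search for it between 0 ≤ φ n and 2 n + 1 > φ n.
-- (Opaque: only the specification IsFloor of the witness is ever used.)
opaque
  floor-exists : ∀ n → ∃[ m ] IsFloor n m
  floor-exists n with last-before-failure (_≤φ n) (λ m → m * m ≤? m * n + n * n)
                        z≤n (suc (n + n)) (<⇒≱ (2n+1>φn n))
  ... | m , m≤φn , m+1≰φn = m , m≤φn , ≰⇒> m+1≰φn

A : ℕ → ℕ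
A n = proj₁ (floor-exists n)

B : ℕ → ℕ
B n = A n + n

A-isFloor : ∀ n → IsFloor n (A n)
A-isFloor n = proj₂ (floor-exists n)

A≤φ : ∀ n → A n ≤φ n
A≤φ n = proj₁ (A-isFloor n)

A+1>φ : ∀ n → suc (A n) >φ n
A+1>φ n = proj₂ (A-isFloor n)

A0≡0 : A 0 ≡ 0
A0≡0 = floor-unique {0} (A-isFloor 0) (z≤n , s≤s z≤n)

A1≡1 : A 1 ≡ 1
A1≡1 = floor-unique {1} {A 1} {1} (A-isFloor 1) (s≤s z≤n , s≤s (s≤s (s≤s (s≤s z≤n))))

-- φ (n + 1) = φ n + φ > m + 1 whenever m ≤ φ n.
≤φ⇒suc<φsuc : ∀ {m n} → m ≤φ n → suc m <φ suc n
≤φ⇒suc<φsuc {m} {n} m≤φn = begin-strict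
  suc m * suc m                                  ≡⟨ solve (m ∷ []) ⟩
  (m * m + m) + suc m                            <⟨ +-mono-≤-< (+-monoˡ-≤ m m≤φn) m+1<3n+2 ⟩
  (m * n + n * n + m) + suc (suc (n + n + n))    ≡⟨ solve (m ∷ n ∷ []) ⟩
  suc m * suc n + suc n * suc n                  ∎
  where
  open ≤-Reasoning
  m≤2n : m ≤ n + n
  m≤2n = ≮⇒≥ (λ 2n<m → <⇒≱ (>φ-monoˡ (2n+1>φn n) 2n<m) m≤φn)
  m+1<3n+2 : suc m < suc (suc (n + n + n))
  m+1<3n+2 = s≤s (s≤s (≤-trans m≤2n (m≤m+n (n + n) n)))

-- A increases strictly: A (n + 1) ≤ A n would give A n + 1 > φ (n + 1).
A-increasing : StrictlyIncreasing A
A-increasing = increasing-by-steps A step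
  where
  step : ∀ n → A n < A (suc n)
  step n = ≰⇒> (λ An+1≤An → <-asym (≤φ⇒suc<φsuc {A n} {n} (A≤φ n))
                   (>φ-monoˡ {suc (A (suc n))} {suc (A n)} {suc n} (A+1>φ (suc n)) (s≤s An+1≤An)))

n≤A : ∀ n → n ≤ A n
n≤A zero = z≤n
n≤A (suc n) = ≤-<-trans (n≤A n) (A-increasing (n<1+n n))

+-cancel-<-⇔ : ∀ K x y → K + x < K + y ⇔ x < y
+-cancel-<-⇔ K x y = mk⇔ (+-cancelˡ-< K x y) (+-monoʳ-< K)

-- Reciprocity (φ − 1 = 1/φ):  φ n < n + j  iff  n < φ j.
+>φ⇔<φ : ∀ n j → n + j >φ n ⇔ n <φ j
+>φ⇔<φ n j = subst₂ (λ X Y → X < Y ⇔ n <φ j) (sym lhs) (sym rhs)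
                     (+-cancel-<-⇔ (n * n + n * j) (n * n) (n * j + j * j))
  where
  lhs : (n + j) * n + n * n ≡ (n * n + n * j) + n * n
  lhs = solve (n ∷ j ∷ [])
  rhs : (n + j) * (n + j) ≡ (n * n + n * j) + (n * j + j * j)
  rhs = solve (n ∷ j ∷ [])

+<φ⇔>φ : ∀ m j → m + j <φ m ⇔ m >φ j
+<φ⇔>φ m j = subst₂ (λ X Y → X < Y ⇔ m >φ j) (sym lhs) (sym rhs)
                     (+-cancel-<-⇔ (m * m + m * j) (m * j + j * j) (m * m))
  where
  lhs : (m + j) * (m + j) ≡ (m * m + m * j) + (m * j + j * j)
  lhs = solve (m ∷ j ∷ [])
  rhs : (m + j) * m + m * m ≡ (m * m + m * j) + m * m
  rhs = solve (m ∷ j ∷ [])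

<φ⇒pos : ∀ {p j} → p <φ j → 1 ≤ j
<φ⇒pos {p} {zero} p<φ0 = ⊥-elim (<⇒≱ p<φ0 (subst (_≤ p * p) (sym (cong (_+ 0) (*-zeroʳ p))) z≤n))
<φ⇒pos {p} {suc j} _ = s≤s z≤n

-- Beatty's theorem for φ, part 1: every natural number is a value of A or a
-- value B j with j ≥ 1.  If A n < a < A (n + 1), reciprocity shows that
-- n = ⌊φ j⌋ for j = a ∸ n, i.e. a = B j.
opaque
  A-or-B : ∀ a → (∃[ n ] (a ≡ A n)) ⊎ (∃[ j ] (1 ≤ j × a ≡ B j))
  A-or-B a with last-before-failure (λ n → A n ≤ a) (λ n → A n ≤? a)
                  (subst (_≤ a) (sym A0≡0) z≤n) (suc a) (<⇒≱ (n≤A (suc a)))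
  ... | n , An≤a , An+1≰a with A n ≟ a
  ... | yes An≡a = inj₁ (n , sym An≡a)
  ... | no An≢a = inj₂ (j , 1≤j , sym Bj≡a)
    where
    a>φn : a >φ n
    a>φn = >φ-monoˡ (A+1>φ n) (≤∧≢⇒< An≤a An≢a)
    a+1<φn+1 : suc a <φ suc n
    a+1<φn+1 = <φ-antimonoˡ (≤φ⇒<φ {A (suc n)} {suc n} (s≤s z≤n) (A≤φ (suc n))) (≰⇒> An+1≰a)
    j : ℕ
    j = a ∸ n
    n+j≡a : n + j ≡ a
    n+j≡a = m+[n∸m]≡n (<⇒≤ (>φ⇒> a>φn))
    n<φj : n <φ j
    n<φj = Equivalence.to (+>φ⇔<φ n j) (subst (_>φ n) (sym n+j≡a) a>φn)
    n+1>φj : suc n >φ j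
    n+1>φj = Equivalence.to (+<φ⇔>φ (suc n) j) (subst (λ x → suc x <φ suc n) (sym n+j≡a) a+1<φn+1)
    Aj≡n : A j ≡ n
    Aj≡n = floor-unique (A-isFloor j) (<⇒≤ n<φj , n+1>φj)
    1≤j : 1 ≤ j
    1≤j = <φ⇒pos {n} n<φj
    Bj≡a : B j ≡ a
    Bj≡a = trans (cong (_+ j) Aj≡n) n+j≡a

-- Beatty's theorem for φ, part 2: no value of A is a value B m with m ≥ 1.
-- If A n = B m = q + m with q = A m, reciprocity pins n strictly between q
-- and q + 1.
A≢B : ∀ {n m} → 1 ≤ m → A n ≢ B m
A≢B {n} {m} 1≤m An≡Bm = <⇒≱ q<n (≤-pred n<q+1)
  where
  q : ℕ
  q = A m
  An>φq : A n >φ q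
  An>φq = subst (_>φ q) (sym An≡Bm)
            (Equivalence.from (+>φ⇔<φ q m) (≤φ⇒<φ {q} {m} 1≤m (A≤φ m)))
  An+1<φq+1 : suc (A n) <φ suc q
  An+1<φq+1 = subst (λ x → suc x <φ suc q) (sym An≡Bm)
                (Equivalence.from (+<φ⇔>φ (suc q) m) (A+1>φ m))
  q<n : q < n
  q<n = ≰⇒> (λ n≤q → <⇒≱ (>φ-antimonoʳ {A n} An>φq n≤q) (A≤φ n))
  n<q+1 : n < suc q
  n<q+1 = ≰⇒> (λ q+1≤n → <-asym (<φ-monoʳ {suc (A n)} An+1<φq+1 q+1≤n) (A+1>φ n))

-- The test of IsFloorPhi, which compares 2 p − n with n √5 by squaring:
-- for x = 2 p − n,  x² ≤ 5 n²  iff  p ≤ φ n,  and  5 n² < x²  iff  p > φ n.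
square-identity : ∀ x n p → x + n ≡ 2 * p → x * x + 4 * (p * n) ≡ 4 * (p * p) + n * n
square-identity x n p x+n≡2p = begin
  x * x + 4 * (p * n)              ≡⟨ solve (x ∷ n ∷ p ∷ []) ⟩
  x * x + 2 * ((2 * p) * n)        ≡⟨ cong (λ y → x * x + 2 * (y * n)) (sym x+n≡2p) ⟩
  x * x + 2 * ((x + n) * n)        ≡⟨ solve (x ∷ n ∷ []) ⟩
  (x + n) * (x + n) + n * n        ≡⟨ cong (λ y → y * y + n * n) x+n≡2p ⟩
  (2 * p) * (2 * p) + n * n        ≡⟨ solve (n ∷ p ∷ []) ⟩
  4 * (p * p) + n * n              ∎
  where open ≡-Reasoning

√5-test-≤ : ∀ x n p → x + n ≡ 2 * p → x * x ≤ 5 * (n * n) ⇔ p ≤φ n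
√5-test-≤ x n p x+n≡2p = mk⇔
  (λ x²≤5n² → *-cancelˡ-≤ 4 (+-cancelʳ-≤ (n * n) _ _ (begin
    4 * (p * p) + n * n              ≡⟨ sym (square-identity x n p x+n≡2p) ⟩
    x * x + 4 * (p * n)              ≤⟨ +-monoˡ-≤ (4 * (p * n)) x²≤5n² ⟩
    5 * (n * n) + 4 * (p * n)        ≡⟨ solve (n ∷ p ∷ []) ⟩
    4 * (p * n + n * n) + n * n      ∎)))
  (λ p≤φn → +-cancelʳ-≤ (4 * (p * n)) _ _ (begin
    x * x + 4 * (p * n)              ≡⟨ square-identity x n p x+n≡2p ⟩
    4 * (p * p) + n * n              ≤⟨ +-monoˡ-≤ (n * n) (*-monoʳ-≤ 4 p≤φn) ⟩
    4 * (p * n + n * n) + n * n      ≡⟨ solve (n ∷ p ∷ []) ⟩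
    5 * (n * n) + 4 * (p * n)        ∎))
  where open ≤-Reasoning

√5-test-< : ∀ x n p → x + n ≡ 2 * p → 5 * (n * n) < x * x ⇔ p >φ n
√5-test-< x n p x+n≡2p = mk⇔
  (λ 5n²<x² → *-cancelˡ-< 4 _ _ (+-cancelʳ-< (n * n) _ _ (begin-strict
    4 * (p * n + n * n) + n * n      ≡⟨ solve (n ∷ p ∷ []) ⟩
    5 * (n * n) + 4 * (p * n)        <⟨ +-monoˡ-< (4 * (p * n)) 5n²<x² ⟩
    x * x + 4 * (p * n)              ≡⟨ square-identity x n p x+n≡2p ⟩
    4 * (p * p) + n * n              ∎)))
  (λ p>φn → +-cancelʳ-< (4 * (p * n)) _ _ (begin-strict
    5 * (n * n) + 4 * (p * n)        ≡⟨ solve (n ∷ p ∷ []) ⟩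
    4 * (p * n + n * n) + n * n      <⟨ +-monoˡ-< (n * n) (*-monoʳ-< 4 p>φn) ⟩
    4 * (p * p) + n * n              ≡⟨ sym (square-identity x n p x+n≡2p) ⟩
    x * x + 4 * (p * n)              ∎))
  where open ≤-Reasoning

isFloorPhi⇔isFloor : ∀ n m → IsFloorPhi n m ⇔ IsFloor n m
isFloorPhi⇔isFloor n m = mk⇔
  (λ (lower , n<2m+2 , upper) → ≤φ-from lower , Equivalence.to (upper-test n<2m+2) upper)
  (λ (m≤φn , m+1>φn) → ≤φ-to m≤φn , n<2m+2 m+1>φn , Equivalence.from (upper-test (n<2m+2 m+1>φn)) m+1>φn)
  where
  2m+2≡2[m+1] : 2 * m + 2 ≡ 2 * suc m
  2m+2≡2[m+1] = solve (m ∷ [])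
  upper-test : n < 2 * m + 2 → 5 * (n * n) < (2 * m + 2 ∸ n) * (2 * m + 2 ∸ n) ⇔ suc m >φ n
  upper-test n<2m+2 = √5-test-< (2 * m + 2 ∸ n) n (suc m) (trans (m∸n+n≡m (<⇒≤ n<2m+2)) 2m+2≡2[m+1])
  n<2m+2 : suc m >φ n → n < 2 * m + 2
  n<2m+2 m+1>φn = <-≤-trans (>φ⇒> m+1>φn) (≤-trans (m≤n+m (suc m) (suc m)) (≤-reflexive double))
    where
    double : suc m + suc m ≡ 2 * m + 2
    double = solve (m ∷ [])
  ≤φ-from : (2 * m ∸ n) * (2 * m ∸ n) ≤ 5 * (n * n) → m ≤φ n
  ≤φ-from lower with n ≤? 2 * m
  ... | yes n≤2m = Equivalence.to (√5-test-≤ (2 * m ∸ n) n m (m∸n+n≡m n≤2m)) lower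
  ... | no n≰2m = <⇒≤ (≤⇒<φ (≤-<-trans z≤n 2m<n) (≤-trans (m≤m+n m (m + 0)) (<⇒≤ 2m<n)))
    where
    2m<n : 2 * m < n
    2m<n = ≰⇒> n≰2m
  ≤φ-to : m ≤φ n → (2 * m ∸ n) * (2 * m ∸ n) ≤ 5 * (n * n)
  ≤φ-to m≤φn with n ≤? 2 * m
  ... | yes n≤2m = Equivalence.from (√5-test-≤ (2 * m ∸ n) n m (m∸n+n≡m n≤2m)) m≤φn
  ... | no n≰2m rewrite m≤n⇒m∸n≡0 (<⇒≤ (≰⇒> n≰2m)) = z≤n

move-swap : ∀ {a b c d} → Move a b c d → Move b a d c
move-swap (nimˡ c<a d≡b) = nimʳ d≡b c<a
move-swap (nimʳ c≡a d<b) = nimˡ d<b c≡a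
move-swap (diag t 1≤t a≡c+t b≡d+t) = diag t 1≤t b≡d+t a≡c+t
move-swap (extˡ a≤b k l l<k a≡c+k b≡d+l) = extʳ a≤b k l l<k a≡c+k b≡d+l
move-swap (extʳ b≤a k l l<k b≡d+k a≡c+l) = extˡ b≤a k l l<k b≡d+k a≡c+l

-- Every move removes at least one token; this is the induction measure.
move-shrinks : ∀ {a b c d} → Move a b c d → c + d < a + b
move-shrinks {d = d} (nimˡ c<a refl) = +-monoˡ-< d c<a
move-shrinks {c = c} (nimʳ refl d<b) = +-monoʳ-< c d<b
move-shrinks {c = c} {d} (diag t 1≤t refl refl) = begin-strict
  c + d                ≤⟨ m≤m+n (c + d) t ⟩
  c + d + t            <⟨ m<m+n (c + d + t) 1≤t ⟩
  c + d + t + t        ≡⟨ solve (c ∷ d ∷ t ∷ []) ⟩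
  c + t + (d + t)      ∎
  where open ≤-Reasoning
move-shrinks {c = c} {d} (extˡ _ k l l<k refl refl) = +-mono-<-≤ (m<m+n c (≤-<-trans z≤n l<k)) (m≤m+n d l)
move-shrinks {c = c} {d} (extʳ _ k l l<k refl refl) = +-mono-≤-< (m≤m+n c l) (m<m+n d (≤-<-trans z≤n l<k))

MovesInto : (ℕ → ℕ → Set) → ℕ → ℕ → Set
MovesInto X a b = ∃[ c ] ∃[ d ] (Move a b c d × X c d)

+-≤-self⇒0 : ∀ {x e} → x + e ≤ x → e ≡ 0
+-≤-self⇒0 {x} {e} x+e≤x = n≤0⇒n≡0 (+-cancelˡ-≤ x e 0 (subst (x + e ≤_) (sym (+-identityʳ x)) x+e≤x))

-- The staircase of two sequences P and δ: the positions (P i , P i + δ i)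
-- and their mirror images (P i + δ i , P i).  Both the positions of value 0
-- (P = A, δ i = i) and those of value 1 (P i = A (i + 1) − 1, δ i = i + 1)
-- are staircases with P and δ strictly increasing, and with no-overlap: a
-- smaller coordinate P i is a larger coordinate P j + δ j only if δ j = 0.
module Staircase (P δ : ℕ → ℕ) (P-inc : StrictlyIncreasing P) (δ-inc : StrictlyIncreasing δ)
                 (no-overlap : ∀ i j → P i ≡ P j + δ j → δ j ≡ 0) where

  Step : ℕ → ℕ → Set
  Step a b = ∃[ i ] (a ≡ P i × b ≡ P i + δ i)

  OnStairs : ℕ → ℕ → Set
  OnStairs a b = Step a b ⊎ Step b a

  onStairs-swap : ∀ {a b} → OnStairs a b → OnStairs b a
  onStairs-swap (inj₁ s) = inj₂ s
  onStairs-swap (inj₂ s) = inj₁ s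

  -- Moving from a step onto a step in the same orientation is impossible:
  -- distinct steps differ in both coordinates and in the difference of the
  -- coordinates, and an extended move from (P i , P i + δ i) would land on a
  -- step with smaller P but larger δ.
  no-move-to-step : ∀ {a b c d} → Step a b → Step c d → Move a b c d → ⊥
  no-move-to-step (i , refl , refl) (j , refl , refl) (nimˡ Pj<Pi Pj+δj≡Pi+δi) =
    <⇒≢ (+-mono-< Pj<Pi (δ-inc (reflect-< P-inc Pj<Pi))) Pj+δj≡Pi+δi
  no-move-to-step (i , refl , refl) (j , refl , refl) (nimʳ Pj≡Pi Pj+δj<Pi+δi)
    with injective P-inc Pj≡Pi
  ... | refl = <-irrefl refl Pj+δj<Pi+δi
  no-move-to-step (i , refl , refl) (j , refl , refl) (diag t 1≤t Pi≡Pj+t Pi+δi≡Pj+δj+t)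
    with injective δ-inc δi≡δj
    where
    δi≡δj : δ i ≡ δ j
    δi≡δj = +-cancelˡ-≡ (P j + t) _ _ (begin
      P j + t + δ i     ≡⟨ cong (_+ δ i) (sym Pi≡Pj+t) ⟩
      P i + δ i         ≡⟨ Pi+δi≡Pj+δj+t ⟩
      P j + δ j + t     ≡⟨ xy∙z≈xz∙y (P j) (δ j) t ⟩
      P j + t + δ j     ∎)
      where open ≡-Reasoning
  ... | refl = <⇒≢ (m<m+n (P i) 1≤t) Pi≡Pj+t
  no-move-to-step (i , refl , refl) (j , refl , refl) (extˡ _ k l l<k Pi≡Pj+k Pi+δi≡Pj+δj+l) =
    <⇒≱ (P-inc (reflect-< δ-inc δi<δj)) (≤-trans (m≤m+n (P j) k) (≤-reflexive (sym Pi≡Pj+k)))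
    where
    k+δi≡δj+l : k + δ i ≡ δ j + l
    k+δi≡δj+l = +-cancelˡ-≡ (P j) _ _ (begin
      P j + (k + δ i)   ≡⟨ sym (+-assoc (P j) k (δ i)) ⟩
      P j + k + δ i     ≡⟨ cong (_+ δ i) (sym Pi≡Pj+k) ⟩
      P i + δ i         ≡⟨ Pi+δi≡Pj+δj+l ⟩
      P j + δ j + l     ≡⟨ +-assoc (P j) (δ j) l ⟩
      P j + (δ j + l)   ∎)
      where open ≡-Reasoning
    δi<δj : δ i < δ j
    δi<δj = ≰⇒> (λ δj≤δi → <⇒≢ (+-mono-≤-< δj≤δi l<k) (sym (trans (+-comm (δ i) k) k+δi≡δj+l)))
  no-move-to-step (i , refl , refl) (j , refl , refl) (extʳ Pi+δi≤Pi k l l<k Pi+δi≡Pj+δj+k Pi≡Pj+l) =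
    <⇒≱ l<k (+-cancelˡ-≤ (P j) k l (begin
      P j + k           ≤⟨ +-monoˡ-≤ k (m≤m+n (P j) (δ j)) ⟩
      P j + δ j + k     ≡⟨ sym Pi+δi≡Pj+δj+k ⟩
      P i + δ i         ≤⟨ Pi+δi≤Pi ⟩
      P i               ≡⟨ Pi≡Pj+l ⟩
      P j + l           ∎))
    where open ≤-Reasoning

  no-move-to-mirror : ∀ {a b c d} → Step a b → Step d c → Move a b c d → ⊥
  no-move-to-mirror (i , refl , refl) (j , refl , refl) (nimˡ Pj+δj<Pi Pj≡Pi+δi) =
    <⇒≱ Pj+δj<Pi (begin
      P i               ≤⟨ m≤m+n (P i) (δ i) ⟩
      P i + δ i         ≡⟨ sym Pj≡Pi+δi ⟩
      P j               ≤⟨ m≤m+n (P j) (δ j) ⟩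
      P j + δ j         ∎)
    where open ≤-Reasoning
  no-move-to-mirror (i , refl , refl) (j , refl , refl) (nimʳ Pj+δj≡Pi Pj<Pi+δi) =
    <⇒≱ Pj<Pi+δi (≤-reflexive (begin
      P i + δ i         ≡⟨ cong (P i +_) δi≡0 ⟩
      P i + 0           ≡⟨ +-identityʳ (P i) ⟩
      P i               ≡⟨ sym Pj≡Pi ⟩
      P j               ∎))
    where
    open ≡-Reasoning
    δj≡0 : δ j ≡ 0
    δj≡0 = no-overlap i j (sym Pj+δj≡Pi)
    Pj≡Pi : P j ≡ P i
    Pj≡Pi = trans (sym (+-identityʳ (P j))) (trans (cong (P j +_) (sym δj≡0)) Pj+δj≡Pi)
    δi≡0 : δ i ≡ 0
    δi≡0 = trans (cong δ (sym (injective P-inc Pj≡Pi))) δj≡0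
  no-move-to-mirror (i , refl , refl) (j , refl , refl) (diag t 1≤t Pi≡Pj+δj+t Pi+δi≡Pj+t) =
    <⇒≱ (δ-inc (reflect-< P-inc Pj<Pi)) (subst (_≤ δ j) (sym δi≡0) z≤n)
    where
    Pj<Pi : P j < P i
    Pj<Pi = <-≤-trans (m<m+n (P j) 1≤t) (≤-trans (+-monoˡ-≤ t (m≤m+n (P j) (δ j))) (≤-reflexive (sym Pi≡Pj+δj+t)))
    δi≡0 : δ i ≡ 0
    δi≡0 = +-≤-self⇒0 (begin
      P i + δ i         ≡⟨ Pi+δi≡Pj+t ⟩
      P j + t           ≤⟨ +-monoˡ-≤ t (m≤m+n (P j) (δ j)) ⟩
      P j + δ j + t     ≡⟨ sym Pi≡Pj+δj+t ⟩
      P i               ∎)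
      where open ≤-Reasoning
  no-move-to-mirror (i , refl , refl) (j , refl , refl) (extˡ _ k l l<k Pi≡Pj+δj+k Pi+δi≡Pj+l) =
    <⇒≱ l<k (+-cancelˡ-≤ (P j) k l (begin
      P j + k           ≤⟨ +-monoˡ-≤ k (m≤m+n (P j) (δ j)) ⟩
      P j + δ j + k     ≡⟨ sym Pi≡Pj+δj+k ⟩
      P i               ≤⟨ m≤m+n (P i) (δ i) ⟩
      P i + δ i         ≡⟨ Pi+δi≡Pj+l ⟩
      P j + l           ∎))
    where open ≤-Reasoning
  no-move-to-mirror (i , refl , refl) (j , refl , refl) (extʳ Pi+δi≤Pi k l l<k Pi+δi≡Pj+k Pi≡Pj+δj+l) =
    <⇒≱ l<k (+-cancelˡ-≤ (P j) k l (begin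
      P j + k           ≡⟨ sym Pi+δi≡Pj+k ⟩
      P i + δ i         ≤⟨ Pi+δi≤Pi ⟩
      P i               ≡⟨ Pi≡Pj+δj+l ⟩
      P j + δ j + l     ≡⟨ cong (λ x → P j + x + l) δj≡0 ⟩
      P j + 0 + l       ≡⟨ cong (_+ l) (+-identityʳ (P j)) ⟩
      P j + l           ∎))
    where
    open ≤-Reasoning
    -- the mirrored step lies below, so its δ is at most δ i = 0
    j≤i : j ≤ i
    j≤i = reflect-≤ P-inc (≤-trans (≤-trans (m≤m+n (P j) (δ j)) (m≤m+n _ l)) (≤-reflexive (sym Pi≡Pj+δj+l)))
    δj≡0 : δ j ≡ 0
    δj≡0 = n≤0⇒n≡0 (≤-trans (monotone δ-inc j≤i) (≤-reflexive (+-≤-self⇒0 Pi+δi≤Pi)))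

  independent : ∀ {a b c d} → OnStairs a b → OnStairs c d → Move a b c d → ⊥
  independent (inj₁ s) (inj₁ t) m = no-move-to-step s t m
  independent (inj₁ s) (inj₂ t) m = no-move-to-mirror s t m
  independent (inj₂ s) (inj₁ t) m = no-move-to-mirror s t (move-swap m)
  independent (inj₂ s) (inj₂ t) m = no-move-to-step s t (move-swap m)

  down-to-step : ∀ {n b} → P n + δ n < b → MovesInto OnStairs (P n) b
  down-to-step {n} Pn+δn<b = P n , P n + δ n , nimʳ refl Pn+δn<b , inj₁ (n , refl , refl)

  down-to-mirror : ∀ {n b} → P n < b → MovesInto OnStairs (P n + δ n) b
  down-to-mirror {n} Pn<b = P n + δ n , P n , nimʳ refl Pn<b , inj₂ (n , refl , refl)

  diagonal-to-step : ∀ {i n} → i < n → MovesInto OnStairs (P n) (P n + δ i)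
  diagonal-to-step {i} {n} i<n =
    P i , P i + δ i , diag t 1≤t (sym Pi+t≡Pn) second-pile , inj₁ (i , refl , refl)
    where
    t : ℕ
    t = P n ∸ P i
    Pi+t≡Pn : P i + t ≡ P n
    Pi+t≡Pn = m+[n∸m]≡n (<⇒≤ (P-inc i<n))
    1≤t : 1 ≤ t
    1≤t = m<n⇒0<n∸m (P-inc i<n)
    second-pile : P n + δ i ≡ P i + δ i + t
    second-pile = trans (cong (_+ δ i) (sym Pi+t≡Pn)) (xy∙z≈xz∙y (P i) t (δ i))

Symmetric : (ℕ → ℕ → Set) → Set
Symmetric X = ∀ {a b} → X a b → X b a

movesInto-swap : ∀ {X} → Symmetric X → Symmetric (MovesInto X)
movesInto-swap X-sym (c , d , m , x) = d , c , move-swap m , X-sym x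

A-no-overlap : ∀ i j → A i ≡ A j + j → j ≡ 0
A-no-overlap i zero _ = refl
A-no-overlap i (suc j) Ai≡Bj = ⊥-elim (A≢B (s≤s z≤n) Ai≡Bj)

module W = Staircase A (λ n → n) A-increasing (λ i<j → i<j) A-no-overlap

Wythoff : ℕ → ℕ → Set
Wythoff = W.OnStairs

-- From every position (a , b) with a ≤ b outside the Wythoff pairs, some move
-- reaches a Wythoff pair: by Beatty's theorem a is A n or B n.
to-Wythoff-ordered : ∀ a b → a ≤ b → Wythoff a b ⊎ MovesInto Wythoff a b
to-Wythoff-ordered a b a≤b with A-or-B a
... | inj₂ (n , 1≤n , refl) = inj₂ (W.down-to-mirror (<-≤-trans (m<m+n (A n) 1≤n) a≤b))
... | inj₁ (n , refl) with <-cmp b (B n)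
...   | tri> _ _ Bn<b = inj₂ (W.down-to-step Bn<b)
...   | tri≈ _ refl _ = inj₁ (inj₁ (n , refl , refl))
...   | tri< b<Bn _ _ = inj₂ (subst (MovesInto Wythoff (A n)) An+e≡b (W.diagonal-to-step e<n))
  where
  e : ℕ
  e = b ∸ A n
  An+e≡b : A n + e ≡ b
  An+e≡b = m+[n∸m]≡n a≤b
  e<n : e < n
  e<n = +-cancelˡ-< (A n) e n (subst (_< B n) (sym An+e≡b) b<Bn)

to-Wythoff : ∀ a b → Wythoff a b ⊎ MovesInto Wythoff a b
to-Wythoff a b with ≤-total a b
... | inj₁ a≤b = to-Wythoff-ordered a b a≤b
... | inj₂ b≤a with to-Wythoff-ordered b a b≤a
...   | inj₁ w = inj₁ (W.onStairs-swap w)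
...   | inj₂ mv = inj₂ (movesInto-swap W.onStairs-swap mv)

A′ : ℕ → ℕ
A′ k = pred (A (suc k))

suc-A′ : ∀ k → suc (A′ k) ≡ A (suc k)
suc-A′ k = suc-pred (A (suc k)) {{>-nonZero (<-≤-trans (s≤s z≤n) (n≤A (suc k)))}}

A′0≡0 : A′ 0 ≡ 0
A′0≡0 = cong pred A1≡1

A′-increasing : StrictlyIncreasing A′
A′-increasing {i} {j} i<j =
  ≤-pred (subst₂ _<_ (sym (suc-A′ i)) (sym (suc-A′ j)) (A-increasing (s≤s i<j)))

A′-no-overlap : ∀ i j → A′ i ≡ A′ j + suc j → suc j ≡ 0
A′-no-overlap i j A′i≡A′j+j+1 = ⊥-elim (A≢B (s≤s z≤n) (begin
  A (suc i)              ≡⟨ sym (suc-A′ i) ⟩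
  suc (A′ i)             ≡⟨ cong suc A′i≡A′j+j+1 ⟩
  suc (A′ j) + suc j     ≡⟨ cong (_+ suc j) (suc-A′ j) ⟩
  B (suc j)              ∎))
  where open ≡-Reasoning

module S = Staircase A′ suc A′-increasing s≤s A′-no-overlap

Shifted : ℕ → ℕ → Set
Shifted = S.OnStairs

-- Every shifted Wythoff pair can move to a Wythoff pair: by Beatty's theorem
-- its smaller pile A′ k is some A n (then n ≤ k) or some B n.
shifted-step-to-Wythoff : ∀ {a b} → S.Step a b → MovesInto Wythoff a b
shifted-step-to-Wythoff (k , refl , refl) with A-or-B (A′ k)
... | inj₁ (n , A′k≡An) =
  subst (λ x → MovesInto Wythoff x (A′ k + suc k)) (sym A′k≡An) (W.down-to-step Bn<b)
  where
  n<k+1 : n < suc k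
  n<k+1 = reflect-< A-increasing (subst (_< A (suc k)) A′k≡An
            (subst (A′ k <_) (suc-A′ k) (n<1+n (A′ k))))
  Bn<b : B n < A′ k + suc k
  Bn<b = subst (λ x → x + n < A′ k + suc k) A′k≡An (+-monoʳ-< (A′ k) n<k+1)
... | inj₂ (n , 1≤n , A′k≡Bn) =
  subst (λ x → MovesInto Wythoff x (A′ k + suc k)) (sym A′k≡Bn) (W.down-to-mirror An<b)
  where
  An<b : A n < A′ k + suc k
  An<b = <-≤-trans (m<m+n (A n) 1≤n) (≤-trans (≤-reflexive (sym A′k≡Bn)) (m≤m+n (A′ k) (suc k)))

shifted-to-Wythoff : ∀ {a b} → Shifted a b → MovesInto Wythoff a b
shifted-to-Wythoff (inj₁ s) = shifted-step-to-Wythoff s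
shifted-to-Wythoff (inj₂ s) = movesInto-swap W.onStairs-swap (shifted-step-to-Wythoff s)

equal-piles : ∀ x → Wythoff x x ⊎ MovesInto Shifted x x
equal-piles zero = inj₁ (inj₁ (0 , sym A0≡0 , sym (cong (_+ 0) A0≡0)))
equal-piles (suc x) =
  inj₂ (0 , 1 , extˡ ≤-refl (suc x) x ≤-refl refl refl , inj₁ (0 , sym A′0≡0 , sym (cong (_+ 1) A′0≡0)))

from-shifted-base : ∀ k b → A′ k ≤ b → Wythoff (A′ k) b ⊎ Shifted (A′ k) b ⊎ MovesInto Shifted (A′ k) b
from-shifted-base k b A′k≤b with <-cmp b (A′ k + suc k)
... | tri> _ _ gt = inj₂ (inj₂ (S.down-to-step gt))
... | tri≈ _ refl _ = inj₂ (inj₁ (inj₁ (k , refl , refl)))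
... | tri< lt _ _ = below (b ∸ A′ k) (m+[n∸m]≡n A′k≤b)
        (+-cancelˡ-< (A′ k) _ _ (subst (_< A′ k + suc k) (sym (m+[n∸m]≡n A′k≤b)) lt))
  where
  below : ∀ e → A′ k + e ≡ b → e < suc k → Wythoff (A′ k) b ⊎ Shifted (A′ k) b ⊎ MovesInto Shifted (A′ k) b
  below zero A′k+0≡b _ with trans (sym (+-identityʳ (A′ k))) A′k+0≡b
  ... | refl with equal-piles (A′ k)
  ...   | inj₁ w = inj₁ w
  ...   | inj₂ mv = inj₂ (inj₂ mv)
  below (suc e) refl (s≤s e<k) = inj₂ (inj₂ (S.diagonal-to-step e<k))

-- From every position (a , b) with a ≤ b that is neither a Wythoff pair nor a
-- shifted Wythoff pair, some move reaches a shifted Wythoff pair: by Beatty's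
-- theorem a + 1 is A (k + 1) or B (k + 1).
to-Shifted-ordered : ∀ a b → a ≤ b → Wythoff a b ⊎ Shifted a b ⊎ MovesInto Shifted a b
to-Shifted-ordered a b a≤b with A-or-B (suc a)
... | inj₁ (zero , 1+a≡A0) = ⊥-elim (1+n≢0 (trans 1+a≡A0 A0≡0))
... | inj₁ (suc k , 1+a≡Ak+1) with suc-injective (trans 1+a≡Ak+1 (sym (suc-A′ k)))
...   | refl = from-shifted-base k b a≤b
to-Shifted-ordered a b a≤b | inj₂ (suc k , _ , 1+a≡Bk+1)
  with suc-injective (trans 1+a≡Bk+1 (cong (_+ suc k) (sym (suc-A′ k))))
... | refl = inj₂ (inj₂ (S.down-to-mirror (<-≤-trans (m<m+n (A′ k) (s≤s z≤n)) a≤b)))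

to-Shifted : ∀ a b → Wythoff a b ⊎ Shifted a b ⊎ MovesInto Shifted a b
to-Shifted a b with ≤-total a b
... | inj₁ a≤b = to-Shifted-ordered a b a≤b
... | inj₂ b≤a with to-Shifted-ordered b a b≤a
...   | inj₁ w = inj₁ (W.onStairs-swap w)
...   | inj₂ (inj₁ s) = inj₂ (inj₁ (S.onStairs-swap s))
...   | inj₂ (inj₂ mv) = inj₂ (inj₂ (movesInto-swap S.onStairs-swap mv))

move-induction : (Q : ℕ → ℕ → Set) →
                 (∀ a b → (∀ {c d} → Move a b c d → Q c d) → Q a b) → ∀ a b → Q a b
move-induction Q step a b = <-rec (λ s → ∀ x y → x + y ≡ s → Q x y)
  (λ s ih x y x+y≡s → step x y (λ m → ih (subst (_ <_) x+y≡s (move-shrinks m)) _ _ refl))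
  (a + b) a b refl

module SpragueGrundy {g : ℕ → ℕ → ℕ} (sg : IsSG g) where

  move-changes-value : ∀ {a b c d} → Move a b c d → g c d ≢ g a b
  move-changes-value {a} {b} {c} {d} m = proj₁ (sg a b) c d m

  smaller-value-reachable : ∀ {a b v} → v < g a b → MovesInto (λ c d → g c d ≡ v) a b
  smaller-value-reachable {a} {b} {v} v<g = proj₂ (sg a b) v v<g

  record Characterised (a b : ℕ) : Set where
    field
      zero⇒Wythoff : g a b ≡ 0 → Wythoff a b
      Wythoff⇒zero : Wythoff a b → g a b ≡ 0
      one⇒Shifted  : g a b ≡ 1 → Shifted a b
      Shifted⇒one  : Shifted a b → g a b ≡ 1

  module InductionStep {a b : ℕ} (ih : ∀ {c d} → Move a b c d → Characterised c d) where
    open Characterised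

    -- A Wythoff pair cannot reach value 0, since Wythoff pairs are independent.
    Wythoff-has-value-0 : Wythoff a b → g a b ≡ 0
    Wythoff-has-value-0 w = n≤0⇒n≡0 (≮⇒≥ λ 0<g →
      let (c , d , m , gcd≡0) = smaller-value-reachable 0<g
      in W.independent w (zero⇒Wythoff (ih m) gcd≡0) m)

    -- Any other position moves to a Wythoff pair, of value 0.
    value-0-is-Wythoff : g a b ≡ 0 → Wythoff a b
    value-0-is-Wythoff g≡0 with to-Wythoff a b
    ... | inj₁ w = w
    ... | inj₂ (c , d , m , w) = ⊥-elim (move-changes-value m (trans (Wythoff⇒zero (ih m) w) (sym g≡0)))

    -- A shifted pair moves to value 0 but cannot reach value 1, since shifted
    -- pairs are independent.
    Shifted-has-value-1 : Shifted a b → g a b ≡ 1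
    Shifted-has-value-1 s = ≤-antisym (≮⇒≥ cannot-reach-1) (n≢0⇒n>0 value≢0)
      where
      value≢0 : g a b ≢ 0
      value≢0 g≡0 with shifted-to-Wythoff s
      ... | c , d , m , w = move-changes-value m (trans (Wythoff⇒zero (ih m) w) (sym g≡0))
      cannot-reach-1 : ¬ (1 < g a b)
      cannot-reach-1 1<g with smaller-value-reachable 1<g
      ... | c , d , m , gcd≡1 = S.independent s (one⇒Shifted (ih m) gcd≡1) m

    -- Any position that is not a shifted pair has value 0 (a Wythoff pair) or
    -- moves to a shifted pair, of value 1.
    value-1-is-Shifted : g a b ≡ 1 → Shifted a b
    value-1-is-Shifted g≡1 with to-Shifted a b
    ... | inj₁ w = ⊥-elim (0≢1+n (trans (sym (Wythoff-has-value-0 w)) g≡1))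
    ... | inj₂ (inj₁ s) = s
    ... | inj₂ (inj₂ (c , d , m , s)) = ⊥-elim (move-changes-value m (trans (Shifted⇒one (ih m) s) (sym g≡1)))

    characterised-step : Characterised a b
    characterised-step = record
      { zero⇒Wythoff = value-0-is-Wythoff
      ; Wythoff⇒zero = Wythoff-has-value-0
      ; one⇒Shifted  = value-1-is-Shifted
      ; Shifted⇒one  = Shifted-has-value-1
      }

  characterised : ∀ a b → Characterised a b
  characterised = move-induction Characterised (λ a b ih → InductionStep.characterised-step ih)

ordered-Shifted⇔ : ∀ a b → a ≤ b →
  Shifted a b ⇔ (∃[ n ] ∃[ m ] (1 ≤ n × IsFloorPhi n m × a ≡ m ∸ 1 × b ≡ m + n ∸ 1))
ordered-Shifted⇔ a b a≤b = mk⇔ to from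
  where
  to : Shifted a b → ∃[ n ] ∃[ m ] (1 ≤ n × IsFloorPhi n m × a ≡ m ∸ 1 × b ≡ m + n ∸ 1)
  to (inj₁ (k , refl , refl)) =
    suc k , A (suc k) , s≤s z≤n ,
    Equivalence.from (isFloorPhi⇔isFloor (suc k) (A (suc k))) (A-isFloor (suc k)) ,
    pred[m∸n]≡m∸[1+n] (A (suc k)) 0 , cong (λ x → x + suc k ∸ 1) (suc-A′ k)
  to (inj₂ (k , refl , refl)) = ⊥-elim (<⇒≱ (m<m+n (A′ k) (s≤s z≤n)) a≤b)
  from : ∃[ n ] ∃[ m ] (1 ≤ n × IsFloorPhi n m × a ≡ m ∸ 1 × b ≡ m + n ∸ 1) → Shifted a b
  from (zero , _ , () , _)
  from (suc k , m , _ , isFloorPhi , refl , refl) = inj₁ (k , first-pile , second-pile)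
    where
    Ak+1≡m : A (suc k) ≡ m
    Ak+1≡m = floor-unique (A-isFloor (suc k)) (Equivalence.to (isFloorPhi⇔isFloor (suc k) m) isFloorPhi)
    first-pile : m ∸ 1 ≡ A′ k
    first-pile = trans (sym (pred[m∸n]≡m∸[1+n] m 0)) (cong pred (sym Ak+1≡m))
    second-pile : m + suc k ∸ 1 ≡ A′ k + suc k
    second-pile = cong (λ x → x + suc k ∸ 1) (trans (sym Ak+1≡m) (sym (suc-A′ k)))

theorem3p2 : (g : ℕ → ℕ → ℕ) → IsSG g → (a b : ℕ) → a ≤ b →
    (g a b ≡ 1 ⇔ (∃[ n ] ∃[ m ] (1 ≤ n × IsFloorPhi n m × a ≡ m ∸ 1 × b ≡ m + n ∸ 1)))
theorem3p2 g sg a b a≤b = ordered-Shifted⇔ a b a≤b ⇔-∘ mk⇔ one⇒Shifted Shifted⇒one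
  where
  open SpragueGrundy sg
  open Characterised (characterised a b)
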